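{- Let $s\geq t\geq 1$ be integers. There is no $r$-regular graph $G$ having the complete bipartite graph $K_{t,s}$ as a star complement for the eigenvalue $\mu=-t$.
   Context: All graphs are finite and simple; eigenvalues are eigenvalues of the adjacency matrix. If $\mu$ is an eigenvalue of a graph $G$ with multiplicity $k\geq 1$, a star set for $\mu$ in $G$ is a vertex subset $X\subseteq V(G)$ with $|X|=k$ such that $\mu$ is not an eigenvalue of the induced subgraph $G-X$ on $V(G)\setminus X$; the graph $H=G-X$ is then called a star complement for $\mu$ in $G$. "$G$ has $K_{t,s}$ as a star complement for $\mu$" means $\mu$ is an eigenvalue of $G$ and some star set $X$ for $\mu$ satisfies $G-X\cong K_{t,s}$. -}

module Defs where

open import Data.Nat as ℕ using (ℕ; zero; suc; _≤_)
open import Data.Integer as ℤ using (ℤ; +_)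
open import Data.Rational using (ℚ; 0ℚ; 1ℚ; _+_; _*_; -_; _/_)
open import Data.Bool using (Bool; true; false; if_then_else_; _xor_)
open import Data.Fin using (Fin; zero; suc; splitAt)
open import Data.Fin.Subset using (Subset; _∈_; _∉_; ∣_∣)
open import Data.Sum using (_⊎_; inj₁; inj₂)
open import Data.Product using (Σ; ∃; _×_; _,_)
open import Relation.Binary.PropositionalEquality using (_≡_; _≢_; refl)
open import Relation.Nullary using (¬_)
open import Function.Definitions using (Injective)

record Graph (n : ℕ) : Set where
  field
    adj    : Fin n → Fin n → Bool
    sym    : ∀ i j → adj i j ≡ adj j i
    irrefl : ∀ i → adj i i ≡ false
open Graph public

count : ∀ {n} → (Fin n → Bool) → ℕ
count {zero}  f = 0
count {suc n} f = (if f zero then 1 else 0) ℕ.+ count (λ i → f (suc i))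

degree : ∀ {n} → Graph n → Fin n → ℕ
degree G v = count (adj G v)

Regular : ∀ {n} → Graph n → ℕ → Set
Regular G r = ∀ v → degree G v ≡ r

sumℚ : ∀ {n} → (Fin n → ℚ) → ℚ
sumℚ {zero}  f = 0ℚ
sumℚ {suc n} f = f zero + sumℚ (λ i → f (suc i))

A : ∀ {n} → Graph n → Fin n → Fin n → ℚ
A G i j = if adj G i j then 1ℚ else 0ℚ

EigenEq : ∀ {n} → Graph n → ℚ → (Fin n → ℚ) → Set
EigenEq G μ x = ∀ i → sumℚ (λ j → A G i j * x j) ≡ μ * x i

IsEigenvalue : ∀ {n} → Graph n → ℚ → Set
IsEigenvalue {n} G μ = Σ (Fin n → ℚ) λ x → EigenEq G μ x × ∃ λ i → x i ≢ 0ℚ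

LinIndep : ∀ {k n} → (Fin k → Fin n → ℚ) → Set
LinIndep {k} {n} v =
  ∀ (c : Fin k → ℚ) → (∀ i → sumℚ (λ j → c j * v j i) ≡ 0ℚ) → ∀ j → c j ≡ 0ℚ

Multiplicity : ∀ {n} → Graph n → ℚ → ℕ → Set
Multiplicity {n} G μ k =
  (Σ (Fin k → Fin n → ℚ) λ v → (∀ a → EigenEq G μ (v a)) × LinIndep v)
  × (∀ (w : Fin (suc k) → Fin n → ℚ) → (∀ a → EigenEq G μ (w a)) → ¬ LinIndep w)

-- H (on Fin m) is the induced subgraph G - X, with vertices relabelled by f :
-- f is a bijection from Fin m onto V(G) \ X and adjacency is inherited from G.
IsDeletion : ∀ {n m} → Graph n → Subset n → Graph m → (Fin m → Fin n) → Set
IsDeletion {n} {m} G X H f =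
  Injective _≡_ _≡_ f
  × (∀ i → f i ∉ X)
  × (∀ v → v ∉ X → ∃ λ i → f i ≡ v)
  × (∀ i j → adj H i j ≡ adj G (f i) (f j))

Isomorphic : ∀ {m p} → Graph m → Graph p → Set
Isomorphic {m} {p} H K =
  Σ (Fin m → Fin p) λ φ → Σ (Fin p → Fin m) λ ψ →
    (∀ i → ψ (φ i) ≡ i) × (∀ j → φ (ψ j) ≡ j)
    × (∀ i j → adj K (φ i) (φ j) ≡ adj H i j)

-- Complete bipartite graph K_{t,s}: first t vertices vs last s vertices.
isLeft : ∀ t {s} → Fin (t ℕ.+ s) → Bool
isLeft t i with splitAt t i
... | inj₁ _ = true
... | inj₂ _ = false

private
  xor-sym : ∀ a b → (a xor b) ≡ (b xor a)
  xor-sym false false = refl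
  xor-sym false true  = refl
  xor-sym true  false = refl
  xor-sym true  true  = refl

  xor-self : ∀ a → (a xor a) ≡ false
  xor-self false = refl
  xor-self true  = refl

K : (t s : ℕ) → Graph (t ℕ.+ s)
K t s = record
  { adj    = λ i j → isLeft t i xor isLeft t j
  ; sym    = λ i j → xor-sym (isLeft t i) (isLeft t j)
  ; irrefl = λ i → xor-self (isLeft t i)
  }

HasStarComplement : ∀ {n p} → Graph n → ℚ → Graph p → Set
HasStarComplement {n} G μ H' =
  Σ ℕ λ k → 1 ≤ k × Multiplicity G μ k ×
  Σ (Subset n) λ X → ∣ X ∣ ≡ k ×
  Σ ℕ λ m → Σ (Graph m) λ H → Σ (Fin m → Fin n) λ f →
    IsDeletion G X H f × ¬ IsEigenvalue H μ × Isomorphic H H'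

negℚ : ℕ → ℚ
negℚ t = - (+ t / 1)

-- If t = s, the vector that is 1 on one side of K_{t,t} and -1 on the other is a (-t)-eigenvector,
-- so -t would be an eigenvalue of the star complement.
--
-- If t < s, let X be the star set, L the left side of K_{t,s} = G - X, and for u ∈ X let
-- D u = |N(u) ∩ L| - t. Because G is r-regular and r ≠ -t, every (-t)-eigenvector x has Σ x = 0,
-- and from A x = -t x one gets ⟨D, x⟩ = 0. The (-t)-eigenvectors restricted to X span ℚ^X (an
-- eigenvector vanishing on X would give the eigenvalue -t to G - X), so D = 0: every vertex of X
-- has exactly t neighbours in L. Counting the edges at L gives r t = |X| t + s t, i.e.
-- r = |X| + s, while a vertex on the right side has degree at most t + |X|. Hence s ≤ t.

module Submission where

open import Defs renaming (sym to adj-sym)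

open import Algebra.Bundles using (CommutativeRing)
open import Data.Bool using (Bool; true; false; if_then_else_; not; _xor_)
open import Data.Empty using (⊥-elim)
open import Data.Fin as Fin using (Fin; zero; suc; punchIn; punchOut; _↑ˡ_; _↑ʳ_)
open import Data.Fin.Properties
  using ( any?; 0≢1+n; suc-injective; splitAt-↑ˡ; splitAt-↑ʳ; punchInᵢ≢i
        ; punchIn-punchOut; punchOut-punchIn; punchOut-cong; punchOut-injective)
open import Data.Fin.Subset using (Subset; _∈_; _∉_; ∣_∣; inside; outside)
open import Data.Fin.Subset.Properties using (_∈?_)
import Data.Integer as ℤ
import Data.Integer.Properties as ℤ
open import Data.Nat as ℕ using (ℕ; zero; suc; _≤_)
import Data.Nat.Properties as ℕ
open import Data.Nat.Coprimality using (1-coprimeTo) renaming (sym to coprime-sym)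
open import Data.Product using (∃; _×_; _,_; proj₁; proj₂)
open import Data.Rational as ℚ using (ℚ; 0ℚ; 1ℚ; _+_; _*_; -_; _-_; _/_; mkℚ; ↥_)
open import Data.Rational.Properties
open import Data.Sum using (inj₁; inj₂)
open import Data.Vec using (_∷_; []; there; lookup)
open import Data.Vec.Properties using (lookup⇒[]=; []=⇒lookup)
open import Data.Vec.Functional using (removeAt; insertAt)
open import Data.Vec.Functional.Properties using (insertAt-lookup; insertAt-punchIn)
open import Function using (_∘_; case_of_)
open import Level using (0ℓ)
open import Function.Definitions using (Injective)
open import Relation.Binary.PropositionalEquality
open import Relation.Nullary using (¬_; yes; no; does)
open import Relation.Nullary.Decidable using (dec⇒maybe; ¬?; decidable-stable; dec-true; dec-false)
open import Tactic.RingSolver using (solve-∀)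
open import Tactic.RingSolver.Core.AlmostCommutativeRing using (AlmostCommutativeRing; fromCommutativeRing)

open import Algebra.Apartness.Properties.HeytingCommutativeRing heytingCommutativeRing
  using (x#0y#0→xy#0)
open import Algebra.Properties.CommutativeSemigroup (CommutativeRing.*-commutativeSemigroup +-*-commutativeRing)
  using (x∙yz≈y∙xz)
open import Algebra.Properties.Group (CommutativeRing.+-group +-*-commutativeRing)
  using (x∙y⁻¹≈ε⇒x≈y; identityˡ-unique)
open import Algebra.Properties.Semiring.Sum (CommutativeRing.semiring +-*-commutativeRing)
  using (sum; sum-cong-≗; sum-replicate-zero; ∑-distrib-+; ∑-comm; *-distribˡ-sum; *-distribʳ-sum; sum-remove)

ℚ-ring : AlmostCommutativeRing 0ℓ 0ℓ
ℚ-ring = fromCommutativeRing +-*-commutativeRing (λ x → dec⇒maybe (0ℚ ≟ x))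

fromℕ : ℕ → ℚ
fromℕ n = ℤ.+ n / 1

fromℕ≡mkℚ : ∀ n → fromℕ n ≡ mkℚ (ℤ.+ n) 0 (coprime-sym (1-coprimeTo n))
fromℕ≡mkℚ n = normalize-coprime (coprime-sym (1-coprimeTo n))

fromℕ-suc : ∀ n → fromℕ (suc n) ≡ 1ℚ + fromℕ n
fromℕ-suc n = trans (sym 1+n≡) (cong (1ℚ +_) (sym (fromℕ≡mkℚ n)))
  where
  1+n≡ : 1ℚ + mkℚ (ℤ.+ n) 0 (coprime-sym (1-coprimeTo n)) ≡ fromℕ (suc n)
  1+n≡ rewrite ℕ.*-identityʳ n | ℤ.+◃n≡+n n = refl

fromℕ-+ : ∀ a b → fromℕ (a ℕ.+ b) ≡ fromℕ a + fromℕ b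
fromℕ-+ zero    b = sym (+-identityˡ (fromℕ b))
fromℕ-+ (suc a) b = begin
  fromℕ (suc a ℕ.+ b)         ≡⟨ fromℕ-suc (a ℕ.+ b) ⟩
  1ℚ + fromℕ (a ℕ.+ b)        ≡⟨ cong (1ℚ +_) (fromℕ-+ a b) ⟩
  1ℚ + (fromℕ a + fromℕ b)    ≡⟨ sym (+-assoc 1ℚ (fromℕ a) (fromℕ b)) ⟩
  (1ℚ + fromℕ a) + fromℕ b    ≡⟨ cong (_+ fromℕ b) (sym (fromℕ-suc a)) ⟩
  fromℕ (suc a) + fromℕ b     ∎
  where open ≡-Reasoning

fromℕ-injective : ∀ {a b} → fromℕ a ≡ fromℕ b → a ≡ b
fromℕ-injective {a} {b} eq = ℤ.+-injective (begin
  ℤ.+ a                 ≡⟨ cong ↥_ (sym (fromℕ≡mkℚ a)) ⟩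
  ↥ fromℕ a             ≡⟨ cong ↥_ eq ⟩
  ↥ fromℕ b             ≡⟨ cong ↥_ (fromℕ≡mkℚ b) ⟩
  ℤ.+ b                 ∎)
  where open ≡-Reasoning

fromℕ-cancel-≤ : ∀ {a b} → fromℕ a ℚ.≤ fromℕ b → a ≤ b
fromℕ-cancel-≤ {a} {b} a≤b rewrite fromℕ≡mkℚ a | fromℕ≡mkℚ b =
  ℕ.*-cancelʳ-≤ a b 1 (ℤ.drop‿+≤+ (subst₂ ℤ._≤_ (ℤ.+◃n≡+n _) (ℤ.+◃n≡+n _) (drop-*≤* a≤b)))

negℚ≢fromℕ : ∀ {t} r → 1 ≤ t → negℚ t ≢ fromℕ r
negℚ≢fromℕ {t} r 1≤t -t≡r = ℕ.<⇒≢ 1≤t (sym (ℕ.m+n≡0⇒n≡0 r (fromℕ-injective (begin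
  fromℕ (r ℕ.+ t)         ≡⟨ fromℕ-+ r t ⟩
  fromℕ r + fromℕ t       ≡⟨ cong (_+ fromℕ t) (sym -t≡r) ⟩
  - fromℕ t + fromℕ t     ≡⟨ +-inverseˡ (fromℕ t) ⟩
  fromℕ 0                 ∎))))
  where open ≡-Reasoning

fromℕ≢0 : ∀ {t} → 1 ≤ t → fromℕ t ≢ 0ℚ
fromℕ≢0 1≤t t≡0 = ℕ.<⇒≢ 1≤t (sym (fromℕ-injective t≡0))

indicator : Bool → ℚ
indicator b = if b then 1ℚ else 0ℚ

indicator-*-≤ : ∀ a b → indicator a * indicator b ℚ.≤ indicator a
indicator-*-≤ true  true  = ≤-reflexive (*-identityˡ 1ℚ)
indicator-*-≤ true  false = ≤-trans (≤-reflexive (*-zeroʳ 1ℚ)) (nonNegative⁻¹ 1ℚ)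
indicator-*-≤ false b     = ≤-reflexive (*-zeroˡ (indicator b))

*≡0⇒≡0 : ∀ {a b} → a ≢ 0ℚ → a * b ≡ 0ℚ → b ≡ 0ℚ
*≡0⇒≡0 {a} {b} a≢0 ab≡0 with b ≟ 0ℚ
... | yes b≡0 = b≡0
... | no  b≢0 = ⊥-elim (x#0y#0→xy#0 a≢0 b≢0 ab≡0)

*≡*⇒[-]*≡0 : ∀ a b z → a * z ≡ b * z → (a - b) * z ≡ 0ℚ
*≡*⇒[-]*≡0 a b z az≡bz = begin
  (a - b) * z     ≡⟨ trans (*-distribʳ-+ z a (- b)) (cong (a * z +_) (sym (neg-distribˡ-* b z))) ⟩
  a * z - b * z   ≡⟨ cong (_- b * z) az≡bz ⟩
  b * z - b * z   ≡⟨ +-inverseʳ (b * z) ⟩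
  0ℚ              ∎
  where open ≡-Reasoning

*-cancelʳ-≡ : ∀ {a b z} → z ≢ 0ℚ → a * z ≡ b * z → a ≡ b
*-cancelʳ-≡ {a} {b} {z} z≢0 az≡bz =
  x∙y⁻¹≈ε⇒x≈y a b (*≡0⇒≡0 z≢0 (trans (*-comm z (a - b)) (*≡*⇒[-]*≡0 a b z az≡bz)))

*≡*⇒≡0 : ∀ {a b z} → a ≢ b → a * z ≡ b * z → z ≡ 0ℚ
*≡*⇒≡0 {a} {b} {z} a≢b az≡bz = *≡0⇒≡0 (a≢b ∘ x∙y⁻¹≈ε⇒x≈y a b) (*≡*⇒[-]*≡0 a b z az≡bz)

sumℚ≡sum : ∀ {n} (f : Fin n → ℚ) → sumℚ f ≡ sum f
sumℚ≡sum {zero}  f = refl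
sumℚ≡sum {suc n} f = cong (f zero +_) (sumℚ≡sum (f ∘ suc))

sum-zero : ∀ {n} {f : Fin n → ℚ} → (∀ i → f i ≡ 0ℚ) → sum f ≡ 0ℚ
sum-zero {n} f≗0 = trans (sum-cong-≗ f≗0) (sum-replicate-zero n)

sum-↑ : ∀ t {s} (f : Fin (t ℕ.+ s) → ℚ) → sum f ≡ sum (f ∘ (_↑ˡ s)) + sum (f ∘ (t ↑ʳ_))
sum-↑ zero    f = sym (+-identityˡ _)
sum-↑ (suc t) f = trans (cong (f zero +_) (sum-↑ t (f ∘ suc))) (sym (+-assoc (f zero) _ _))

sum-mono-≤ : ∀ {n} {f g : Fin n → ℚ} → (∀ i → f i ℚ.≤ g i) → sum f ℚ.≤ sum g
sum-mono-≤ {zero}  f≤g = ≤-refl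
sum-mono-≤ {suc n} f≤g = +-mono-≤ (f≤g zero) (sum-mono-≤ (f≤g ∘ suc))

sum-reindex : ∀ {m n} (h : Fin m → Fin n) → Injective _≡_ _≡_ h → (F : Fin n → ℚ) →
              (∀ v → (∀ i → h i ≢ v) → F v ≡ 0ℚ) → sum F ≡ sum (F ∘ h)
sum-reindex {zero}  h h-inj F F-supp = sum-zero (λ v → F-supp v (λ ()))
sum-reindex {suc m} {zero}  h h-inj F F-supp with h zero
... | ()
sum-reindex {suc m} {suc n} h h-inj F F-supp = begin
  sum F                                    ≡⟨ sum-remove {i = h zero} F ⟩
  F (h zero) + sum (removeAt F (h zero))   ≡⟨ cong (F (h zero) +_) (sum-reindex h′ h′-inj _ F′-supp) ⟩
  F (h zero) + sum (removeAt F (h zero) ∘ h′)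
    ≡⟨ cong (F (h zero) +_) (sum-cong-≗ (λ j → cong F (punchIn-punchOut (h₀≢h₁₊ j)))) ⟩
  sum (F ∘ h)                              ∎
  where
  open ≡-Reasoning
  h₀≢h₁₊ : ∀ j → h zero ≢ h (suc j)
  h₀≢h₁₊ j eq = 0≢1+n (h-inj eq)
  h′ : Fin m → Fin n
  h′ j = punchOut (h₀≢h₁₊ j)
  h′-inj : Injective _≡_ _≡_ h′
  h′-inj eq = suc-injective (h-inj (punchOut-injective (h₀≢h₁₊ _) (h₀≢h₁₊ _) eq))
  F′-supp : ∀ v → (∀ j → h′ j ≢ v) → removeAt F (h zero) v ≡ 0ℚ
  F′-supp v v∉h′ = F-supp (punchIn (h zero) v) λ
    { zero    eq → punchInᵢ≢i _ _ (sym eq)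
    ; (suc j) eq → v∉h′ j (trans (punchOut-cong (h zero) eq) (punchOut-punchIn (h zero))) }

sum-const : ∀ n (c : ℚ) → sum {n} (λ _ → c) ≡ fromℕ n * c
sum-const zero    c = sym (*-zeroˡ c)
sum-const (suc n) c = begin
  c + sum {n} (λ _ → c)   ≡⟨ cong (c +_) (sum-const n c) ⟩
  c + fromℕ n * c         ≡⟨ cong (_+ fromℕ n * c) (sym (*-identityˡ c)) ⟩
  1ℚ * c + fromℕ n * c    ≡⟨ sym (*-distribʳ-+ c 1ℚ (fromℕ n)) ⟩
  (1ℚ + fromℕ n) * c      ≡⟨ cong (_* c) (sym (fromℕ-suc n)) ⟩
  fromℕ (suc n) * c       ∎
  where open ≡-Reasoning

sum-indicator : ∀ {n} (b : Fin n → Bool) → sum (indicator ∘ b) ≡ fromℕ (count b)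
sum-indicator {zero}  b = refl
sum-indicator {suc n} b with b zero
... | true  = trans (cong (1ℚ +_) (sum-indicator (b ∘ suc))) (sym (fromℕ-suc (count (b ∘ suc))))
... | false = trans (+-identityˡ _) (sum-indicator (b ∘ suc))

-- Linear independence on a set of coordinates

lincomb : ∀ {k n} → (Fin k → ℚ) → (Fin k → Fin n → ℚ) → Fin n → ℚ
lincomb c v i = sum (λ j → c j * v j i)

IndepOn : ∀ {k n} → Subset n → (Fin k → Fin n → ℚ) → Set
IndepOn X v = ∀ c → (∀ i → i ∈ X → lincomb c v i ≡ 0ℚ) → ∀ j → c j ≡ 0ℚ

-- Gaussian elimination of column zero, with pivot u p zero.
module _ {k n} (u : Fin (suc k) → Fin (suc n) → ℚ) (p : Fin (suc k)) where

  private
    π : ℚ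
    π = u p zero
    w : Fin k → Fin (suc n) → ℚ
    w = u ∘ punchIn p

  eliminate : Fin k → Fin (suc n) → ℚ
  eliminate l i = π * w l i - w l zero * u p i

  eliminate-zero : ∀ l → eliminate l zero ≡ 0ℚ
  eliminate-zero l = ab-ba≡0 π (w l zero)
    where
    ab-ba≡0 : ∀ a b → a * b - b * a ≡ 0ℚ
    ab-ba≡0 = solve-∀ ℚ-ring

  unEliminate : (Fin k → ℚ) → Fin (suc k) → ℚ
  unEliminate c = insertAt (λ l → π * c l) p (- lincomb c w zero)

  lincomb-unEliminate : ∀ c i → lincomb (unEliminate c) u i ≡ lincomb c eliminate i
  lincomb-unEliminate c i = begin
    lincomb (unEliminate c) u i
      ≡⟨ sum-remove {i = p} (λ j → unEliminate c j * u j i) ⟩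
    unEliminate c p * u p i + sum (λ l → unEliminate c (punchIn p l) * w l i)
      ≡⟨ cong₂ _+_ (cong (_* u p i) (insertAt-lookup _ p _))
                   (sum-cong-≗ (λ l → cong (_* w l i) (insertAt-punchIn _ p _ l))) ⟩
    - S * u p i + sum (λ l → π * c l * w l i)
      ≡⟨ cong (_+ sum (λ l → π * c l * w l i)) (begin
           - S * u p i                            ≡⟨ sym (neg-distribˡ-* S (u p i)) ⟩
           - (S * u p i)                          ≡⟨ neg-distribʳ-* S (u p i) ⟩
           S * - u p i                            ≡⟨ *-distribʳ-sum (- u p i) (λ l → c l * w l zero) ⟩
           sum (λ l → c l * w l zero * - u p i)   ∎) ⟩
    sum (λ l → c l * w l zero * - u p i) + sum (λ l → π * c l * w l i)
      ≡⟨ sym (∑-distrib-+ (λ l → c l * w l zero * - u p i) (λ l → π * c l * w l i)) ⟩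
    sum (λ l → c l * w l zero * - u p i + π * c l * w l i)
      ≡⟨ sum-cong-≗ (λ l → regroup (c l) π (w l i) (w l zero) (u p i)) ⟩
    lincomb c eliminate i ∎
    where
    open ≡-Reasoning
    S : ℚ
    S = lincomb c w zero
    regroup : ∀ c π a b z → c * b * - z + π * c * a ≡ c * (π * a - b * z)
    regroup = solve-∀ ℚ-ring

¬IndepOn[1+∣X∣] : ∀ {n} (X : Subset n) (u : Fin (suc ∣ X ∣) → Fin n → ℚ) → ¬ IndepOn X u
¬IndepOn[1+∣X∣] [] u indep = 1≢0 (indep (λ _ → 1ℚ) (λ ()) zero)
¬IndepOn[1+∣X∣] (outside ∷ X) u indep =
  ¬IndepOn[1+∣X∣] X (λ j → u j ∘ suc) (λ c vanish → indep c λ { (suc i) (there i∈X) → vanish i i∈X })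
¬IndepOn[1+∣X∣] (inside ∷ X) u indep with any? (λ p → ¬? (u p zero ≟ 0ℚ))
... | yes (p , pivot≢0) = ¬IndepOn[1+∣X∣] X (λ l → eliminate u p l ∘ suc) indep′
  where
  indep′ : IndepOn X (λ l → eliminate u p l ∘ suc)
  indep′ c vanish l = *≡0⇒≡0 pivot≢0 (trans (sym (insertAt-punchIn _ p _ l))
                                            (indep (unEliminate u p c) vanish′ (punchIn p l)))
    where
    vanish′ : ∀ i → i ∈ inside ∷ X → lincomb (unEliminate u p c) u i ≡ 0ℚ
    vanish′ zero    _           = trans (lincomb-unEliminate u p c zero)
      (sum-zero (λ l → trans (cong (c l *_) (eliminate-zero u p l)) (*-zeroʳ (c l))))
    vanish′ (suc i) (there i∈X) = trans (lincomb-unEliminate u p c (suc i)) (vanish i i∈X)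
... | no no-pivot = ¬IndepOn[1+∣X∣] X (λ j → u (suc j) ∘ suc) indep′
  where
  column₀≡0 : ∀ p → u p zero ≡ 0ℚ
  column₀≡0 p = decidable-stable (u p zero ≟ 0ℚ) (λ u≢0 → no-pivot (p , u≢0))
  indep′ : IndepOn X (λ j → u (suc j) ∘ suc)
  indep′ c vanish j = indep (insertAt c zero 0ℚ) vanish′ (suc j)
    where
    drop-row₀ : ∀ i → lincomb (insertAt c zero 0ℚ) u i ≡ lincomb c (u ∘ suc) i
    drop-row₀ i = trans (cong (_+ lincomb c (u ∘ suc) i) (*-zeroˡ (u zero i))) (+-identityˡ _)
    vanish′ : ∀ i → i ∈ inside ∷ X → lincomb (insertAt c zero 0ℚ) u i ≡ 0ℚ
    vanish′ zero    _           = trans (drop-row₀ zero)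
      (sum-zero (λ j → trans (cong (c j *_) (column₀≡0 (suc j))) (*-zeroʳ (c j))))
    vanish′ (suc i) (there i∈X) = trans (drop-row₀ (suc i)) (vanish i i∈X)

⟨_,_⟩ : ∀ {n} → (Fin n → ℚ) → (Fin n → ℚ) → ℚ
⟨ x , y ⟩ = sum (λ i → x i * y i)

⟨-,lincomb⟩ : ∀ {k n} (x : Fin n → ℚ) (c : Fin k → ℚ) (w : Fin k → Fin n → ℚ) →
              ⟨ x , lincomb c w ⟩ ≡ sum (λ j → c j * ⟨ x , w j ⟩)
⟨-,lincomb⟩ x c w = begin
  sum (λ i → x i * sum (λ j → c j * w j i))
    ≡⟨ sum-cong-≗ (λ i → *-distribˡ-sum (x i) (λ j → c j * w j i)) ⟩
  sum (λ i → sum (λ j → x i * (c j * w j i)))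
    ≡⟨ ∑-comm (λ i j → x i * (c j * w j i)) ⟩
  sum (λ j → sum (λ i → x i * (c j * w j i)))
    ≡⟨ sum-cong-≗ (λ j → sum-cong-≗ (λ i → x∙yz≈y∙xz (x i) (c j) (w j i))) ⟩
  sum (λ j → sum (λ i → c j * (x i * w j i)))
    ≡⟨ sum-cong-≗ (λ j → sym (*-distribˡ-sum (c j) (λ i → x i * w j i))) ⟩
  sum (λ j → c j * ⟨ x , w j ⟩)                    ∎
  where open ≡-Reasoning

⟨⟩-comm : ∀ {n} (x y : Fin n → ℚ) → ⟨ x , y ⟩ ≡ ⟨ y , x ⟩
⟨⟩-comm x y = sum-cong-≗ (λ i → *-comm (x i) (y i))

⟨lincomb,-⟩ : ∀ {k n} (c : Fin k → ℚ) (w : Fin k → Fin n → ℚ) (x : Fin n → ℚ) →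
              ⟨ lincomb c w , x ⟩ ≡ sum (λ j → c j * ⟨ w j , x ⟩)
⟨lincomb,-⟩ c w x = begin
  ⟨ lincomb c w , x ⟩             ≡⟨ ⟨⟩-comm (lincomb c w) x ⟩
  ⟨ x , lincomb c w ⟩             ≡⟨ ⟨-,lincomb⟩ x c w ⟩
  sum (λ j → c j * ⟨ x , w j ⟩)   ≡⟨ sum-cong-≗ (λ j → cong (c j *_) (⟨⟩-comm x (w j))) ⟩
  sum (λ j → c j * ⟨ w j , x ⟩)   ∎
  where open ≡-Reasoning

unit : ∀ {n} → Fin n → Fin n → ℚ
unit z i = indicator (does (z Fin.≟ i))

⟨-,unit⟩ : ∀ {n} (x : Fin n → ℚ) (z : Fin n) → ⟨ x , unit z ⟩ ≡ x z
⟨-,unit⟩ {suc n} x z = begin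
  ⟨ x , unit z ⟩                                  ≡⟨ sum-remove {i = z} (λ i → x i * unit z i) ⟩
  x z * unit z z + sum (λ l → x (punchIn z l) * unit z (punchIn z l))
    ≡⟨ cong₂ _+_ (cong (λ b → x z * indicator b) (dec-true (z Fin.≟ z) refl)) (sum-zero off-z) ⟩
  x z * 1ℚ + 0ℚ                                   ≡⟨ trans (+-identityʳ _) (*-identityʳ (x z)) ⟩
  x z                                             ∎
  where
  open ≡-Reasoning
  off-z : ∀ l → x (punchIn z l) * unit z (punchIn z l) ≡ 0ℚ
  off-z l = trans (cong (λ b → x (punchIn z l) * indicator b)
                        (dec-false (z Fin.≟ punchIn z l) (punchInᵢ≢i z l ∘ sym)))
                  (*-zeroʳ (x (punchIn z l)))

-- If D were nonzero at z, the unit vector at z could be adjoined to v keeping independence on X.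
supported-orthogonal⇒zero : ∀ {n} (X : Subset n) (v : Fin ∣ X ∣ → Fin n → ℚ) → IndepOn X v →
                            (D : Fin n → ℚ) → (∀ i → i ∉ X → D i ≡ 0ℚ) → (∀ j → ⟨ D , v j ⟩ ≡ 0ℚ) →
                            ∀ z → D z ≡ 0ℚ
supported-orthogonal⇒zero {n} X v v-indep D D-supp D⊥v z with D z ≟ 0ℚ
... | yes Dz≡0 = Dz≡0
... | no  Dz≢0 = ⊥-elim (¬IndepOn[1+∣X∣] X w w-indep)
  where
  w : Fin (suc ∣ X ∣) → Fin n → ℚ
  w = insertAt v zero (unit z)
  w-indep : IndepOn X w
  w-indep c vanish = coefficients
    where
    D⊥comb : ⟨ D , lincomb c w ⟩ ≡ 0ℚ
    D⊥comb = sum-zero λ i → case i ∈? X of λ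
      { (yes i∈X) → trans (cong (D i *_) (vanish i i∈X)) (*-zeroʳ (D i))
      ; (no  i∉X) → trans (cong (_* lincomb c w i) (D-supp i i∉X)) (*-zeroˡ (lincomb c w i)) }
    c₀*Dz≡0 : c zero * D z ≡ 0ℚ
    c₀*Dz≡0 = begin
      c zero * D z                         ≡⟨ sym (+-identityʳ _) ⟩
      c zero * D z + 0ℚ                    ≡⟨ cong₂ _+_ (cong (c zero *_) (sym (⟨-,unit⟩ D z)))
                                                        (sym (sum-zero (λ j → D⊥w₁₊ j))) ⟩
      sum (λ j → c j * ⟨ D , w j ⟩)        ≡⟨ sym (⟨-,lincomb⟩ D c w) ⟩
      ⟨ D , lincomb c w ⟩                  ≡⟨ D⊥comb ⟩
      0ℚ                                   ∎
      where
      open ≡-Reasoning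
      D⊥w₁₊ : ∀ j → c (suc j) * ⟨ D , v j ⟩ ≡ 0ℚ
      D⊥w₁₊ j = trans (cong (c (suc j) *_) (D⊥v j)) (*-zeroʳ (c (suc j)))
    c₀≡0 : c zero ≡ 0ℚ
    c₀≡0 = *≡0⇒≡0 Dz≢0 (trans (*-comm (D z) (c zero)) c₀*Dz≡0)
    coefficients : ∀ j → c j ≡ 0ℚ
    coefficients zero    = c₀≡0
    coefficients (suc j) = v-indep (c ∘ suc) (λ i i∈X → trans (sym (drop-unit i)) (vanish i i∈X)) j
      where
      drop-unit : ∀ i → lincomb c w i ≡ lincomb (c ∘ suc) v i
      drop-unit i = trans (cong (λ a → a * unit z i + lincomb (c ∘ suc) v i) c₀≡0)
                          (trans (cong (_+ lincomb (c ∘ suc) v i) (*-zeroˡ (unit z i))) (+-identityˡ _))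

_·ᴬ_ : ∀ {n} → Graph n → (Fin n → ℚ) → Fin n → ℚ
(G ·ᴬ x) i = ⟨ A G i , x ⟩

module _ {n} (G : Graph n) (μ : ℚ) {x : Fin n → ℚ} where

  EigenEq⇒·ᴬ : EigenEq G μ x → ∀ i → (G ·ᴬ x) i ≡ μ * x i
  EigenEq⇒·ᴬ eigen i = trans (sym (sumℚ≡sum (λ j → A G i j * x j))) (eigen i)

  ·ᴬ⇒EigenEq : (∀ i → (G ·ᴬ x) i ≡ μ * x i) → EigenEq G μ x
  ·ᴬ⇒EigenEq eigen i = trans (sumℚ≡sum (λ j → A G i j * x j)) (eigen i)

lincomb-EigenEq : ∀ {k n} (G : Graph n) (μ : ℚ) (c : Fin k → ℚ) {v : Fin k → Fin n → ℚ} →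
                  (∀ j → EigenEq G μ (v j)) → EigenEq G μ (lincomb c v)
lincomb-EigenEq G μ c {v} v-eigen = ·ᴬ⇒EigenEq G μ λ i → begin
  ⟨ A G i , lincomb c v ⟩               ≡⟨ ⟨-,lincomb⟩ (A G i) c v ⟩
  sum (λ j → c j * ⟨ A G i , v j ⟩)     ≡⟨ sum-cong-≗ (λ j → cong (c j *_) (EigenEq⇒·ᴬ G μ (v-eigen j) i)) ⟩
  sum (λ j → c j * (μ * v j i))         ≡⟨ sum-cong-≗ (λ j → x∙yz≈y∙xz (c j) μ (v j i)) ⟩
  sum (λ j → μ * (c j * v j i))         ≡⟨ sym (*-distribˡ-sum μ (λ j → c j * v j i)) ⟩
  μ * lincomb c v i                     ∎
  where open ≡-Reasoning

⟨rows,-⟩ : ∀ {k n} (G : Graph n) (μ : ℚ) (c : Fin k → ℚ) (g : Fin k → Fin n) {x} → EigenEq G μ x →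
           ⟨ lincomb c (A G ∘ g) , x ⟩ ≡ μ * ⟨ c , x ∘ g ⟩
⟨rows,-⟩ G μ c g {x} eigen = begin
  ⟨ lincomb c (A G ∘ g) , x ⟩           ≡⟨ ⟨lincomb,-⟩ c (A G ∘ g) x ⟩
  sum (λ a → c a * (G ·ᴬ x) (g a))      ≡⟨ sum-cong-≗ (λ a → cong (c a *_) (EigenEq⇒·ᴬ G μ eigen (g a))) ⟩
  sum (λ a → c a * (μ * x (g a)))       ≡⟨ sum-cong-≗ (λ a → x∙yz≈y∙xz (c a) μ (x (g a))) ⟩
  sum (λ a → μ * (c a * x (g a)))       ≡⟨ sym (*-distribˡ-sum μ (λ a → c a * x (g a))) ⟩
  μ * ⟨ c , x ∘ g ⟩                     ∎
  where open ≡-Reasoning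

module _ {n} {G : Graph n} {r : ℕ} (regular : Regular G r) where

  row-sum : ∀ v → sum (A G v) ≡ fromℕ r
  row-sum v = trans (sum-indicator (adj G v)) (cong fromℕ (regular v))

  column-sum : ∀ v → sum (λ w → A G w v) ≡ fromℕ r
  column-sum v = trans (sum-cong-≗ (λ w → cong indicator (adj-sym G w v))) (row-sum v)

  regular⇒EigenEq-1 : EigenEq G (fromℕ r) (λ _ → 1ℚ)
  regular⇒EigenEq-1 = ·ᴬ⇒EigenEq G (fromℕ r) λ v → begin
    sum (λ w → A G v w * 1ℚ)   ≡⟨ sum-cong-≗ (λ w → *-identityʳ (A G v w)) ⟩
    sum (A G v)                ≡⟨ row-sum v ⟩
    fromℕ r                    ≡⟨ sym (*-identityʳ (fromℕ r)) ⟩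
    fromℕ r * 1ℚ               ∎
    where open ≡-Reasoning

  EigenEq⇒sum≡0 : ∀ {μ x} → μ ≢ fromℕ r → EigenEq G μ x → sum x ≡ 0ℚ
  EigenEq⇒sum≡0 {μ} {x} μ≢r eigen = *≡*⇒≡0 μ≢r (begin
    μ * sum x                                    ≡⟨ *-distribˡ-sum μ x ⟩
    sum (λ v → μ * x v)                          ≡⟨ sum-cong-≗ (λ v → sym (EigenEq⇒·ᴬ G μ eigen v)) ⟩
    sum (λ v → sum (λ w → A G v w * x w))        ≡⟨ ∑-comm (λ v w → A G v w * x w) ⟩
    sum (λ w → sum (λ v → A G v w * x w))        ≡⟨ sum-cong-≗ (λ w → sym (*-distribʳ-sum (x w) (λ v → A G v w))) ⟩
    sum (λ w → sum (λ v → A G v w) * x w)        ≡⟨ sum-cong-≗ (λ w → cong (_* x w) (column-sum w)) ⟩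
    sum (λ w → fromℕ r * x w)                    ≡⟨ sym (*-distribˡ-sum (fromℕ r) x) ⟩
    fromℕ r * sum x                              ∎)
    where open ≡-Reasoning

Isomorphic⇒IsEigenvalue : ∀ {m p} {H : Graph m} {H′ : Graph p} {μ} → Isomorphic H H′ →
                          IsEigenvalue H′ μ → IsEigenvalue H μ
Isomorphic⇒IsEigenvalue {H = H} {H′} {μ} (φ , ψ , ψφ , φψ , φ-adj) (x , eigen , i , xᵢ≢0) =
  x ∘ φ , ·ᴬ⇒EigenEq H μ eigen-φ , ψ i , xᵢ≢0 ∘ trans (cong x (sym (φψ i)))
  where
  φ-inj : Injective _≡_ _≡_ φ
  φ-inj {i} {j} eq = trans (sym (ψφ i)) (trans (cong ψ eq) (ψφ j))
  eigen-φ : ∀ j → (H ·ᴬ (x ∘ φ)) j ≡ μ * x (φ j)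
  eigen-φ j = begin
    sum (λ l → A H j l * x (φ l))          ≡⟨ sum-cong-≗ (λ l → cong (λ b → indicator b * x (φ l))
                                                                     (sym (φ-adj j l))) ⟩
    sum (λ l → A H′ (φ j) (φ l) * x (φ l)) ≡⟨ sym (sum-reindex φ φ-inj _ (λ b b∉φ → ⊥-elim (b∉φ (ψ b) (φψ b)))) ⟩
    (H′ ·ᴬ x) (φ j)                        ≡⟨ EigenEq⇒·ᴬ H′ μ eigen (φ j) ⟩
    μ * x (φ j)                            ∎
    where open ≡-Reasoning

-- Star sets

EnumeratesComplement : ∀ {m n} → Subset n → (Fin m → Fin n) → Set
EnumeratesComplement X f = Injective _≡_ _≡_ f × (∀ i → f i ∉ X) × (∀ v → v ∉ X → ∃ λ i → f i ≡ v)

χ : ∀ {n} → Subset n → Fin n → ℚ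
χ X v = indicator (lookup X v)

sum-χ : ∀ {n} (X : Subset n) → sum (χ X) ≡ fromℕ ∣ X ∣
sum-χ X = trans (sum-indicator (lookup X)) (cong fromℕ (count-lookup X))
  where
  count-lookup : ∀ {n} (X : Subset n) → count (lookup X) ≡ ∣ X ∣
  count-lookup []          = refl
  count-lookup (true ∷ X)  = cong suc (count-lookup X)
  count-lookup (false ∷ X) = count-lookup X

lookup-∉ : ∀ {n} {X : Subset n} {v} → v ∉ X → lookup X v ≡ false
lookup-∉ {X = X} {v} v∉X with lookup X v in eq
... | true  = ⊥-elim (v∉X (lookup⇒[]= v X eq))
... | false = refl

module _ {m n} {X : Subset n} {f : Fin m → Fin n} (enum : EnumeratesComplement X f) where

  private
    f-inj : Injective _≡_ _≡_ f
    f-inj = proj₁ enum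
    f∉X : ∀ i → f i ∉ X
    f∉X = proj₁ (proj₂ enum)
    f-onto : ∀ v → v ∉ X → ∃ λ i → f i ≡ v
    f-onto = proj₂ (proj₂ enum)

  sum-vanishing-on : ∀ (F : Fin n → ℚ) → (∀ v → v ∈ X → F v ≡ 0ℚ) → sum F ≡ sum (F ∘ f)
  sum-vanishing-on F F-X = sum-reindex f f-inj F F-supp
    where
    F-supp : ∀ v → (∀ i → f i ≢ v) → F v ≡ 0ℚ
    F-supp v v∉f with v ∈? X
    ... | yes v∈X = F-X v v∈X
    ... | no  v∉X = ⊥-elim (v∉f (proj₁ (f-onto v v∉X)) (proj₂ (f-onto v v∉X)))

  sum-split : ∀ (F : Fin n → ℚ) → sum F ≡ sum (λ v → χ X v * F v) + sum (F ∘ f)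
  sum-split F = begin
    sum F                                            ≡⟨ sum-cong-≗ (λ v → split (lookup X v) (F v)) ⟩
    sum (λ v → χ X v * F v + Fᶜ v)                   ≡⟨ ∑-distrib-+ (λ v → χ X v * F v) Fᶜ ⟩
    sum (λ v → χ X v * F v) + sum Fᶜ                 ≡⟨ cong (sum (λ v → χ X v * F v) +_)
                                                           (trans (sum-vanishing-on Fᶜ Fᶜ-X) (sum-cong-≗ Fᶜ-f)) ⟩
    sum (λ v → χ X v * F v) + sum (F ∘ f)            ∎
    where
    open ≡-Reasoning
    Fᶜ : Fin n → ℚ
    Fᶜ v = indicator (not (lookup X v)) * F v
    split : ∀ b x → x ≡ indicator b * x + indicator (not b) * x
    split true  x = sym (trans (cong (1ℚ * x +_) (*-zeroˡ x)) (trans (+-identityʳ _) (*-identityˡ x)))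
    split false x = sym (trans (cong (_+ 1ℚ * x) (*-zeroˡ x)) (trans (+-identityˡ _) (*-identityˡ x)))
    Fᶜ-X : ∀ v → v ∈ X → Fᶜ v ≡ 0ℚ
    Fᶜ-X v v∈X = trans (cong (λ b → indicator (not b) * F v) ([]=⇒lookup v∈X)) (*-zeroˡ (F v))
    Fᶜ-f : ∀ i → Fᶜ (f i) ≡ F (f i)
    Fᶜ-f i = trans (cong (λ b → indicator (not b) * F (f i)) (lookup-∉ (f∉X i))) (*-identityˡ (F (f i)))

module Deletion {n m} (G : Graph n) {X : Subset n} {H : Graph m} {f : Fin m → Fin n}
                (deletion : IsDeletion G X H f) where

  private
    H-adj : ∀ i j → adj H i j ≡ adj G (f i) (f j)
    H-adj = proj₂ (proj₂ (proj₂ deletion))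

  IsDeletion⇒EnumeratesComplement : EnumeratesComplement X f
  IsDeletion⇒EnumeratesComplement =
    proj₁ deletion , proj₁ (proj₂ deletion) , proj₁ (proj₂ (proj₂ deletion))

  EigenEq-restrict : ∀ {μ x} → EigenEq G μ x → (∀ v → v ∈ X → x v ≡ 0ℚ) → EigenEq H μ (x ∘ f)
  EigenEq-restrict {μ} {x} eigen x-X = ·ᴬ⇒EigenEq H μ λ i → begin
    sum (λ j → A H i j * x (f j))         ≡⟨ sum-cong-≗ (λ j → cong (λ b → indicator b * x (f j)) (H-adj i j)) ⟩
    sum (λ j → A G (f i) (f j) * x (f j)) ≡⟨ sym (sum-vanishing-on IsDeletion⇒EnumeratesComplement _ (Ax-X i)) ⟩
    (G ·ᴬ x) (f i)                        ≡⟨ EigenEq⇒·ᴬ G μ eigen (f i) ⟩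
    μ * x (f i)                           ∎
    where
    open ≡-Reasoning
    Ax-X : ∀ i v → v ∈ X → A G (f i) v * x v ≡ 0ℚ
    Ax-X i v v∈X = trans (cong (A G (f i) v *_) (x-X v v∈X)) (*-zeroʳ (A G (f i) v))

  module _ {μ} (μ∉H : ¬ IsEigenvalue H μ) where

    EigenEq-vanishing-on-star-set : ∀ {x} → EigenEq G μ x → (∀ v → v ∈ X → x v ≡ 0ℚ) → ∀ v → x v ≡ 0ℚ
    EigenEq-vanishing-on-star-set {x} eigen x-X v with v ∈? X
    ... | yes v∈X = x-X v v∈X
    ... | no  v∉X with proj₂ (proj₂ IsDeletion⇒EnumeratesComplement) v v∉X
    ...   | i , refl = decidable-stable (x (f i) ≟ 0ℚ)
                           (λ x≢0 → μ∉H (x ∘ f , EigenEq-restrict {μ} eigen x-X , i , x≢0))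

    LinIndep⇒IndepOn : ∀ {k} {v : Fin k → Fin n → ℚ} → (∀ j → EigenEq G μ (v j)) → LinIndep v →
                       IndepOn X v
    LinIndep⇒IndepOn {v = v} v-eigen v-indep c vanish =
      v-indep c (λ i → trans (sumℚ≡sum (λ j → c j * v j i))
                             (EigenEq-vanishing-on-star-set (lincomb-EigenEq G μ c v-eigen) vanish i))

    ⊥eigenspace⇒≡0 : ∀ {k} (v : Fin k → Fin n → ℚ) → (∀ j → EigenEq G μ (v j)) → LinIndep v →
                     ∣ X ∣ ≡ k →
                     (D : Fin n → ℚ) → (∀ w → w ∉ X → D w ≡ 0ℚ) →
                     (∀ x → EigenEq G μ x → ⟨ D , x ⟩ ≡ 0ℚ) → ∀ w → D w ≡ 0ℚ
    ⊥eigenspace⇒≡0 v v-eigen v-indep refl D D-supp D⊥ =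
      supported-orthogonal⇒zero X v (LinIndep⇒IndepOn v-eigen v-indep) D D-supp
                                (λ j → D⊥ (v j) (v-eigen j))

isLeft-↑ˡ : ∀ t {s} (a : Fin t) → isLeft t (a ↑ˡ s) ≡ true
isLeft-↑ˡ t {s} a rewrite splitAt-↑ˡ t a s = refl

isLeft-↑ʳ : ∀ t {s} (b : Fin s) → isLeft t (t ↑ʳ b) ≡ false
isLeft-↑ʳ t {s} b rewrite splitAt-↑ʳ t s b = refl

sum-by-side : ∀ t s (F : Bool → ℚ) →
              sum (λ a → F (isLeft t {s} a)) ≡ fromℕ t * F true + fromℕ s * F false
sum-by-side t s F = begin
  sum (λ a → F (isLeft t {s} a))                     ≡⟨ sum-↑ t {s} (λ a → F (isLeft t a)) ⟩
  sum (λ a → F (isLeft t {s} (a ↑ˡ s))) + sum (λ b → F (isLeft t {s} (t ↑ʳ b)))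
    ≡⟨ cong₂ _+_ (sum-cong-≗ (cong F ∘ isLeft-↑ˡ t {s})) (sum-cong-≗ (cong F ∘ isLeft-↑ʳ t {s})) ⟩
  sum {t} (λ _ → F true) + sum {s} (λ _ → F false)
    ≡⟨ cong₂ _+_ (sum-const t (F true)) (sum-const s (F false)) ⟩
  fromℕ t * F true + fromℕ s * F false               ∎
  where open ≡-Reasoning

sign : Bool → ℚ
sign true  = 1ℚ
sign false = - 1ℚ

K-EigenEq-sign : ∀ t → EigenEq (K t t) (negℚ t) (sign ∘ isLeft t)
K-EigenEq-sign t = ·ᴬ⇒EigenEq (K t t) (negℚ t) λ a →
  trans (sum-by-side t t (λ b → indicator (isLeft t a xor b) * sign b)) (by-side (isLeft t a))
  where
  by-side : ∀ l → fromℕ t * (indicator (l xor true) * 1ℚ) + fromℕ t * (indicator (l xor false) * - 1ℚ)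
                  ≡ negℚ t * sign l
  by-side true  = left (fromℕ t)
    where
    left : ∀ T → T * (0ℚ * 1ℚ) + T * (1ℚ * - 1ℚ) ≡ - T * 1ℚ
    left = solve-∀ ℚ-ring
  by-side false = right (fromℕ t)
    where
    right : ∀ T → T * (1ℚ * 1ℚ) + T * (0ℚ * - 1ℚ) ≡ - T * - 1ℚ
    right = solve-∀ ℚ-ring

K-IsEigenvalue : ∀ t → 1 ≤ t → IsEigenvalue (K t t) (negℚ t)
K-IsEigenvalue (suc t) _ = sign ∘ isLeft (suc t) , K-EigenEq-sign (suc t) , zero , 1≢0

module StarComplementK
  {n} {G : Graph n} {r} (regular : Regular G r)
  {t s} (1≤t : 1 ≤ t)
  {X : Subset n} {m} {H : Graph m} {f : Fin m → Fin n} (deletion : IsDeletion G X H f)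
  (-t∉H : ¬ IsEigenvalue H (negℚ t)) (H≅K : Isomorphic H (K t s))
  {k} (v : Fin k → Fin n → ℚ) (v-eigen : ∀ j → EigenEq G (negℚ t) (v j)) (v-indep : LinIndep v)
  (∣X∣≡k : ∣ X ∣ ≡ k)
  where

  open Deletion G {X} {H} {f} deletion

  private
    μ : ℚ
    μ = negℚ t
    φ : Fin m → Fin (t ℕ.+ s)
    φ = proj₁ H≅K
    ψ : Fin (t ℕ.+ s) → Fin m
    ψ = proj₁ (proj₂ H≅K)
    ψφ : ∀ i → ψ (φ i) ≡ i
    ψφ = proj₁ (proj₂ (proj₂ H≅K))
    φψ : ∀ a → φ (ψ a) ≡ a
    φψ = proj₁ (proj₂ (proj₂ (proj₂ H≅K)))
    φ-adj : ∀ i j → adj (K t s) (φ i) (φ j) ≡ adj H i j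
    φ-adj = proj₂ (proj₂ (proj₂ (proj₂ H≅K)))
    H-adj : ∀ i j → adj H i j ≡ adj G (f i) (f j)
    H-adj = proj₂ (proj₂ (proj₂ deletion))
    f-enum : EnumeratesComplement X f
    f-enum = IsDeletion⇒EnumeratesComplement

  e : Fin (t ℕ.+ s) → Fin n
  e = f ∘ ψ

  e-enum : EnumeratesComplement X e
  e-enum = (λ eq → trans (sym (φψ _)) (trans (cong φ (proj₁ f-enum eq)) (φψ _)))
         , (λ a → proj₁ (proj₂ f-enum) (ψ a))
         , λ w w∉X → case proj₂ (proj₂ f-enum) w w∉X of λ { (i , refl) → φ i , cong f (ψφ i) }

  e-adj : ∀ a b → A G (e a) (e b) ≡ A (K t s) a b
  e-adj a b = cong indicator (trans (sym (H-adj (ψ a) (ψ b)))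
                             (trans (sym (φ-adj (ψ a) (ψ b))) (cong₂ (adj (K t s)) (φψ a) (φψ b))))

  L : Fin (t ℕ.+ s) → ℚ
  L a = indicator (isLeft t a)

  leftDegree : Fin n → ℚ
  leftDegree = lincomb L (A G ∘ e)

  leftDegree-e : ∀ b → leftDegree (e b) ≡ fromℕ t * indicator (not (isLeft t b))
  leftDegree-e b = begin
    sum (λ a → L a * A G (e a) (e b))              ≡⟨ sum-cong-≗ (λ a → cong (L a *_) (e-adj a b)) ⟩
    sum (λ a → L a * A (K t s) a b)                ≡⟨ sum-by-side t s (λ l → indicator l * indicator (l xor ℓ)) ⟩
    fromℕ t * (1ℚ * indicator (not ℓ)) + fromℕ s * (0ℚ * indicator ℓ)
                                                   ≡⟨ only-left (fromℕ t) (fromℕ s) (indicator (not ℓ)) (indicator ℓ) ⟩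
    fromℕ t * indicator (not ℓ)                    ∎
    where
    open ≡-Reasoning
    ℓ : Bool
    ℓ = isLeft t b
    only-left : ∀ T S x y → T * (1ℚ * x) + S * (0ℚ * y) ≡ T * x
    only-left = solve-∀ ℚ-ring

  excess : Fin n → ℚ
  excess w = leftDegree w - fromℕ t

  excess-e : ∀ a → excess (e a) ≡ μ * L a
  excess-e a = trans (cong (_- fromℕ t) (leftDegree-e a)) (by-side (isLeft t a))
    where
    by-side : ∀ l → fromℕ t * indicator (not l) - fromℕ t ≡ μ * indicator l
    by-side true  = left (fromℕ t)
      where
      left : ∀ T → T * 0ℚ - T ≡ - T * 1ℚ
      left = solve-∀ ℚ-ring
    by-side false = right (fromℕ t)
      where
      right : ∀ T → T * 1ℚ - T ≡ - T * 0ℚ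
      right = solve-∀ ℚ-ring

  ⟨excess,-⟩ : ∀ {x} → EigenEq G μ x → ⟨ excess , x ⟩ ≡ μ * ⟨ L , x ∘ e ⟩
  ⟨excess,-⟩ {x} eigen = begin
    ⟨ excess , x ⟩
      ≡⟨ sum-cong-≗ (λ w → *-distribʳ-+ (x w) (leftDegree w) (- fromℕ t)) ⟩
    sum (λ w → leftDegree w * x w + - fromℕ t * x w)
      ≡⟨ ∑-distrib-+ (λ w → leftDegree w * x w) (λ w → - fromℕ t * x w) ⟩
    ⟨ leftDegree , x ⟩ + sum (λ w → - fromℕ t * x w)
      ≡⟨ cong₂ _+_ (⟨rows,-⟩ G μ L e eigen) (sym (*-distribˡ-sum (- fromℕ t) x)) ⟩
    μ * ⟨ L , x ∘ e ⟩ + - fromℕ t * sum x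
      ≡⟨ cong (λ S → μ * ⟨ L , x ∘ e ⟩ + - fromℕ t * S) Σx≡0 ⟩
    μ * ⟨ L , x ∘ e ⟩ + - fromℕ t * 0ℚ
      ≡⟨ trans (cong (μ * ⟨ L , x ∘ e ⟩ +_) (*-zeroʳ (- fromℕ t))) (+-identityʳ _) ⟩
    μ * ⟨ L , x ∘ e ⟩                                ∎
    where
    open ≡-Reasoning
    Σx≡0 : sum x ≡ 0ℚ
    Σx≡0 = EigenEq⇒sum≡0 {G = G} regular {μ} {x} (negℚ≢fromℕ r 1≤t) eigen

  D : Fin n → ℚ
  D w = χ X w * excess w

  -- On the vertices of K the excess is μ L, so they alone already contribute all of ⟨excess, x⟩.
  D⊥eigenvectors : ∀ x → EigenEq G μ x → ⟨ D , x ⟩ ≡ 0ℚ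
  D⊥eigenvectors x eigen = trans (sum-cong-≗ (λ w → *-assoc (χ X w) (excess w) (x w)))
                                 (identityˡ-unique _ _ (begin
    sum (λ w → χ X w * (excess w * x w)) + sum (λ a → excess (e a) * x (e a))
      ≡⟨ sym (sum-split e-enum (λ w → excess w * x w)) ⟩
    ⟨ excess , x ⟩
      ≡⟨ ⟨excess,-⟩ eigen ⟩
    μ * ⟨ L , x ∘ e ⟩
      ≡⟨ *-distribˡ-sum μ (λ a → L a * x (e a)) ⟩
    sum (λ a → μ * (L a * x (e a)))
      ≡⟨ sum-cong-≗ (λ a → trans (sym (*-assoc μ (L a) (x (e a))))
                                   (cong (_* x (e a)) (sym (excess-e a)))) ⟩
    sum (λ a → excess (e a) * x (e a))                                        ∎))
    where open ≡-Reasoning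

  D≡0 : ∀ w → D w ≡ 0ℚ
  D≡0 = ⊥eigenspace⇒≡0 {μ = μ} -t∉H v v-eigen v-indep ∣X∣≡k D
          (λ w w∉X → trans (cong (λ b → indicator b * excess w) (lookup-∉ w∉X)) (*-zeroˡ (excess w)))
          D⊥eigenvectors

  χ-leftDegree : ∀ w → χ X w * leftDegree w ≡ χ X w * fromℕ t
  χ-leftDegree w = begin
    χ X w * leftDegree w                         ≡⟨ split (χ X w) (leftDegree w) (fromℕ t) ⟩
    χ X w * excess w + χ X w * fromℕ t     ≡⟨ cong (_+ χ X w * fromℕ t) (D≡0 w) ⟩
    0ℚ + χ X w * fromℕ t                   ≡⟨ +-identityˡ _ ⟩
    χ X w * fromℕ t                        ∎
    where
    open ≡-Reasoning
    split : ∀ c d T → c * d ≡ c * (d - T) + c * T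
    split = solve-∀ ℚ-ring

  -- Double counting the edges at the left side: its t vertices have degree r, while by D ≡ 0 every
  -- vertex of X has t neighbours there, as has every right vertex.
  r≡k+s : r ≡ k ℕ.+ s
  r≡k+s = fromℕ-injective (*-cancelʳ-≡ (fromℕ≢0 1≤t) (begin
    fromℕ r * fromℕ t                                  ≡⟨ cong (fromℕ r *_) (sym ⟨L,1⟩) ⟩
    fromℕ r * ⟨ L , (λ _ → 1ℚ) ⟩                       ≡⟨ sym (⟨rows,-⟩ G (fromℕ r) L e 1-eigen) ⟩
    ⟨ leftDegree , (λ _ → 1ℚ) ⟩                              ≡⟨ sum-cong-≗ (λ w → *-identityʳ (leftDegree w)) ⟩
    sum leftDegree                                           ≡⟨ sum-split e-enum leftDegree ⟩
    sum (λ w → χ X w * leftDegree w) + sum (leftDegree ∘ e)        ≡⟨ cong₂ _+_ (sum-cong-≗ χ-leftDegree) (sum-cong-≗ leftDegree-e) ⟩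
    sum (λ w → χ X w * fromℕ t) + sum (λ a → fromℕ t * indicator (not (isLeft t a)))
      ≡⟨ cong₂ _+_ (trans (sym (*-distribʳ-sum (fromℕ t) (χ X))) (cong (_* fromℕ t) (sum-χ X)))
                   (sum-by-side t s (λ l → fromℕ t * indicator (not l))) ⟩
    fromℕ ∣ X ∣ * fromℕ t + (fromℕ t * (fromℕ t * 0ℚ) + fromℕ s * (fromℕ t * 1ℚ))
      ≡⟨ collect (fromℕ ∣ X ∣) (fromℕ s) (fromℕ t) ⟩
    (fromℕ ∣ X ∣ + fromℕ s) * fromℕ t                  ≡⟨ cong (λ j → (fromℕ j + fromℕ s) * fromℕ t) ∣X∣≡k ⟩
    (fromℕ k + fromℕ s) * fromℕ t                      ≡⟨ cong (_* fromℕ t) (sym (fromℕ-+ k s)) ⟩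
    fromℕ (k ℕ.+ s) * fromℕ t                          ∎))
    where
    open ≡-Reasoning
    1-eigen : EigenEq G (fromℕ r) (λ _ → 1ℚ)
    1-eigen = regular⇒EigenEq-1 {G = G} regular
    ⟨L,1⟩ : ⟨ L , (λ _ → 1ℚ) ⟩ ≡ fromℕ t
    ⟨L,1⟩ = trans (sum-by-side t s (λ l → indicator l * 1ℚ)) (only-left (fromℕ t) (fromℕ s))
      where
      only-left : ∀ T S → T * (1ℚ * 1ℚ) + S * (0ℚ * 1ℚ) ≡ T
      only-left = solve-∀ ℚ-ring
    collect : ∀ K S T → K * T + (T * (T * 0ℚ) + S * (T * 1ℚ)) ≡ (K + S) * T
    collect = solve-∀ ℚ-ring

  s≤t : 1 ≤ s → s ≤ t
  s≤t 1≤s = ℕ.+-cancelˡ-≤ k s t (fromℕ-cancel-≤ (begin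
    fromℕ (k ℕ.+ s)                                           ≡⟨ cong fromℕ (sym r≡k+s) ⟩
    fromℕ r                                                   ≡⟨ sym (row-sum {G = G} regular w₀) ⟩
    sum (A G w₀)                                              ≡⟨ sum-split e-enum (A G w₀) ⟩
    sum (λ w → χ X w * A G w₀ w) + sum (λ a → A G w₀ (e a))
                                                              ≤⟨ +-mono-≤ X-neighbours (≤-reflexive left-neighbours) ⟩
    fromℕ k + fromℕ t                                         ≡⟨ sym (fromℕ-+ k t) ⟩
    fromℕ (k ℕ.+ t)                                           ∎))
    where
    open ≤-Reasoning
    b₀ : Fin (t ℕ.+ s)
    b₀ = t ↑ʳ Fin.fromℕ< 1≤s
    b₀-right : isLeft t b₀ ≡ false
    b₀-right = isLeft-↑ʳ t (Fin.fromℕ< 1≤s)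
    w₀ : Fin n
    w₀ = e b₀
    X-neighbours : sum (λ w → χ X w * A G w₀ w) ℚ.≤ fromℕ k
    X-neighbours = ≤-trans (sum-mono-≤ (λ w → indicator-*-≤ (lookup X w) (adj G w₀ w)))
                           (≤-reflexive (trans (sum-χ X) (cong fromℕ ∣X∣≡k)))
    left-neighbours : sum (λ a → A G w₀ (e a)) ≡ fromℕ t
    left-neighbours = begin-equality
      sum (λ a → A G w₀ (e a))                          ≡⟨ sum-cong-≗ (λ a → trans (e-adj b₀ a)
                                                             (cong (λ l → indicator (l xor isLeft t a)) b₀-right)) ⟩
      sum (λ a → indicator (isLeft t {s} a))            ≡⟨ sum-by-side t s indicator ⟩
      fromℕ t * 1ℚ + fromℕ s * 0ℚ                       ≡⟨ only-left (fromℕ t) (fromℕ s) ⟩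
      fromℕ t                                           ∎
      where
      only-left : ∀ T S → T * 1ℚ + S * 0ℚ ≡ T
      only-left = solve-∀ ℚ-ring

proposition3p3 : (s t : ℕ) → 1 ≤ t → t ≤ s →
    ∀ (n : ℕ) (G : Graph n) (r : ℕ) → Regular G r →
    ¬ HasStarComplement G (negℚ t) (K t s)
proposition3p3 s t 1≤t t≤s n G r regular
  (k , _ , ((v , v-eigen , v-indep) , _) , X , ∣X∣≡k , m , H , f , deletion , -t∉H , H≅K)
  with ℕ.m≤n⇒m<n∨m≡n t≤s
... | inj₂ refl = -t∉H (Isomorphic⇒IsEigenvalue {H = H} {H′ = K t t} {μ = negℚ t} H≅K (K-IsEigenvalue t 1≤t))
... | inj₁ t<s  = ℕ.<⇒≱ t<s (StarComplementK.s≤t {G = G} regular 1≤t {X = X} {H = H} {f = f} deletion -t∉H H≅K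
                                                  v v-eigen v-indep ∣X∣≡k (ℕ.≤-trans 1≤t t≤s))
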